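{- Let $V$ be a finite set, and let $P$ be an induced subposet of the Boolean lattice $\mathbf{2}^V$ (all subsets of $V$ ordered by inclusion) such that $\emptyset$, $V$ and all singletons $\{v\}$, $v\in V$, belong to $P$. Then for any two antichains $A,B\subseteq P$, we have $B=A^*$ (the blocker of $A$ in $P$) if and only if the following holds: for all $U\in P$, the set $V\setminus U$ contains no member of $A$ if and only if $U$ contains a member of $B$.
   Context: A poset is bounded if it has a unique bottom element $\hat 0$ and a unique top element $\hat 1$. For a finite bounded poset $P$, $\Lambda$ denotes its set of atoms (elements covering $\hat 0$), and for $x\in P$, $\Lambda(x)\subseteq\Lambda$ is the set of atoms below $x$. An antichain in $P$ is a nonempty subset $A\subseteq P$ with $\hat 0\notin A$ whose elements are pairwise incomparable. The blocker of an antichain $A$ is $A^*=\min\{x\in P : \Lambda(x)\cap\Lambda(a)\neq\emptyset \text{ for every } a\in A\}$, where $\min E$ is the set of minimal elements of $E$. Here $P$ is bounded with $\hat 0=\emptyset$, $\hat 1=V$, and its atoms are the singletons. -}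

module Defs where

open import Data.Nat using (ℕ)
open import Data.Fin using (Fin)
open import Data.Fin.Subset using (Subset; _⊆_; _⊂_; ⊥; ⊤; ⁅_⁆; ∁)
open import Data.Product using (_×_; ∃; Σ)
open import Relation.Binary.PropositionalEquality using (_≡_)
open import Relation.Nullary using (¬_)
open import Level using (0ℓ)
open import Relation.Unary using (Pred)

Family : ℕ → Set₁
Family n = Pred (Subset n) 0ℓ

record Admissible {n : ℕ} (P : Family n) : Set where
  field
    has-⊥ : P ⊥
    has-⊤ : P ⊤
    has-singletons : ∀ (v : Fin n) → P ⁅ v ⁆

IsAtom : ∀ {n} → Family n → Subset n → Set
IsAtom P t = P t × (⊥ ⊂ t) × (∀ y → P y → ⊥ ⊂ y → ¬ (y ⊂ t))

-- Λ(x) ∩ Λ(a) ≠ ∅ : some atom of P lies below both x and a.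
SharesAtom : ∀ {n} → Family n → Subset n → Subset n → Set
SharesAtom P x a = ∃ λ t → IsAtom P t × t ⊆ x × t ⊆ a

record IsAntichain {n : ℕ} (P A : Family n) : Set where
  field
    nonempty : ∃ λ x → A x
    ⊆P : ∀ x → A x → P x
    no-⊥ : ¬ A ⊥
    incomparable : ∀ x y → A x → A y → x ⊆ y → x ≡ y

Transversal : ∀ {n} → Family n → Family n → Subset n → Set
Transversal P A x = P x × (∀ a → A a → SharesAtom P x a)

Minimal : ∀ {n} → Family n → Subset n → Set
Minimal E x = E x × (∀ y → E y → ¬ (y ⊂ x))

Blocker : ∀ {n} → Family n → Family n → Family n
Blocker P A = Minimal (Transversal P A)

{-# OPTIONS --safe #-}
-- Since P contains every singleton, the atoms of P are exactly the singletons, so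
-- "x shares an atom with a" just means that x and a intersect, and the transversals
-- of A are the U ∈ P for which ∁ U contains no member of A.  The transversals form
-- an up-closed family in P, and an antichain of P is the set of minimal elements of
-- such a family iff the family is the up-closure of the antichain in P; minimal
-- elements below a given transversal exist because proper inclusion is well founded.
module Submission where

open import Defs
open import Data.Nat using (ℕ)
open import Data.Nat.Induction using (<-wellFounded)
open import Data.Fin.Properties using (any?)
open import Data.Fin.Subset
  using (Subset; _⊆_; _⊂_; _∈_; _∩_; ∁; ⁅_⁆; ∣_∣; Nonempty)
open import Data.Fin.Subset.Properties
  using ( _∈?_; _⊆?_; _⊂?_; nonempty?; anySubset?; ⊥⊆; ∉⊥; x∈⁅x⁆; x∈⁅y⁆⇒x≡y
        ; x∈p∩q⁺; x∈p∩q⁻; x∉p⇒x∈∁p; x∈∁p⇒x∉p; p⊂q⇒∣p∣<∣q∣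
        ; ⊆-refl; ⊆-trans; ⊆-antisym; ⊂-irref; ⊆-⊂-trans)
open import Data.Product using (_×_; ∃; _,_; proj₁; proj₂)
open import Data.Sum using (_⊎_; inj₁; inj₂)
open import Induction.WellFounded using (WellFounded; Acc; acc; module Subrelation)
open import Relation.Binary.Construct.On as On using ()
open import Relation.Binary.PropositionalEquality using (_≡_; refl)
open import Relation.Nullary using (¬_; yes; no; contradiction)
open import Relation.Nullary.Decidable using (_×-dec_; ¬?; decidable-stable; map)
open import Relation.Unary using (Decidable)
open import Function.Bundles using (_⇔_; mk⇔; Equivalence)
open import Function.Properties.Equivalence using () renaming (sym to ⇔-sym; trans to ⇔-trans)

open Equivalence

module _ {n : ℕ} where

  ⊂-wellFounded : WellFounded (_⊂_ {n})
  ⊂-wellFounded =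
    Subrelation.wellFounded p⊂q⇒∣p∣<∣q∣ (On.wellFounded ∣_∣ <-wellFounded)

  ⊆⇒⊂⊎≡ : {p q : Subset n} → p ⊆ q → p ⊂ q ⊎ p ≡ q
  ⊆⇒⊂⊎≡ {p} {q} p⊆q with any? (λ i → (i ∈? q) ×-dec ¬? (i ∈? p))
  ... | yes (i , i∈q , i∉p) = inj₁ (p⊆q , i , i∈q , i∉p)
  ... | no ∄ = inj₂ (⊆-antisym p⊆q λ {i} i∈q →
                 decidable-stable (i ∈? p) (λ i∉p → ∄ (i , i∈q , i∉p)))

  Nonempty∩⇔¬⊆∁ : {p q : Subset n} → Nonempty (p ∩ q) ⇔ (¬ q ⊆ ∁ p)
  Nonempty∩⇔¬⊆∁ {p} {q} = mk⇔ disjoint-contra nonempty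
    where
    disjoint-contra : Nonempty (p ∩ q) → ¬ q ⊆ ∁ p
    disjoint-contra (i , i∈p∩q) q⊆∁p =
      let (i∈p , i∈q) = x∈p∩q⁻ p q i∈p∩q in x∈∁p⇒x∉p (q⊆∁p i∈q) i∈p
    nonempty : ¬ q ⊆ ∁ p → Nonempty (p ∩ q)
    nonempty q⊈∁p = decidable-stable (nonempty? (p ∩ q)) λ empty →
      q⊈∁p λ {i} i∈q → x∉p⇒x∈∁p λ i∈p → empty (i , x∈p∩q⁺ (i∈p , i∈q))

  ∃-minimal-⊆ : {E : Family n} → Decidable E →
                ∀ {U} → E U → ∃ λ y → y ⊆ U × Minimal E y
  ∃-minimal-⊆ {E} E? {U} = go (⊂-wellFounded U)
    where
    go : ∀ {U} → Acc _⊂_ U → E U → ∃ λ y → y ⊆ U × Minimal E y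
    go {U} (acc rs) EU with anySubset? (λ y → E? y ×-dec (y ⊂? U))
    ... | yes (y , Ey , y⊂U) =
      let (z , z⊆y , z-min) = go (rs y⊂U) Ey in z , ⊆-trans z⊆y (proj₁ y⊂U) , z-min
    ... | no ∄ = U , ⊆-refl , EU , λ y Ey y⊂U → ∄ (y , Ey , y⊂U)

  ↑_ : Family n → Family n
  ↑ B = λ U → ∃ λ b → B b × b ⊆ U

  UpClosedIn : Family n → Family n → Set
  UpClosedIn P E = ∀ {x U} → E x → x ⊆ U → P U → E U

  minimal⇒↑ : {P E B : Family n} → Decidable E → UpClosedIn P E →
              (∀ x → B x ⇔ Minimal E x) → ∀ U → P U → E U ⇔ (↑ B) U
  minimal⇒↑ {E = E} {B} E? up B≡min U PU = mk⇔
    (λ EU → minimal-below (∃-minimal-⊆ E? EU))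
    (λ (b , Bb , b⊆U) → up (proj₁ (to (B≡min b) Bb)) b⊆U PU)
    where
    minimal-below : (∃ λ y → y ⊆ U × Minimal E y) → (↑ B) U
    minimal-below (y , y⊆U , y-min) = y , from (B≡min y) y-min , y⊆U

  ↑⇒minimal : {P E B : Family n} → (∀ x → E x → P x) → IsAntichain P B →
              (∀ U → P U → E U ⇔ (↑ B) U) → ∀ x → B x ⇔ Minimal E x
  ↑⇒minimal {P} {E} {B} E⊆P antichain E≡↑B x = mk⇔ minimal antichain-member
    where
    open IsAntichain antichain
    B⊆E : ∀ b → B b → E b
    B⊆E b Bb = from (E≡↑B b (⊆P b Bb)) (b , Bb , ⊆-refl)
    minimal : B x → Minimal E x
    minimal Bx = B⊆E x Bx , λ y Ey y⊂x →
      let (b , Bb , b⊆y) = to (E≡↑B y (E⊆P y Ey)) Ey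
          b⊂x = ⊆-⊂-trans b⊆y y⊂x
      in ⊂-irref (incomparable b x Bb Bx (proj₁ b⊂x)) b⊂x
    antichain-member : Minimal E x → B x
    antichain-member (Ex , x-min) with to (E≡↑B x (E⊆P x Ex)) Ex
    ... | b , Bb , b⊆x with ⊆⇒⊂⊎≡ b⊆x
    ...   | inj₁ b⊂x = contradiction b⊂x (x-min b (B⊆E b Bb))
    ...   | inj₂ refl = Bb

  minimal⇔↑ : {P E B : Family n} → Decidable E → (∀ x → E x → P x) → UpClosedIn P E →
              IsAntichain P B →
              (∀ x → B x ⇔ Minimal E x) ⇔ (∀ U → P U → E U ⇔ (↑ B) U)
  minimal⇔↑ E? E⊆P up antichain =
    mk⇔ (minimal⇒↑ E? up) (↑⇒minimal E⊆P antichain)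

module _ {n : ℕ} {P : Family n} where

  sharesAtom⇒Nonempty∩ : ∀ {x a} → SharesAtom P x a → Nonempty (x ∩ a)
  sharesAtom⇒Nonempty∩ (t , (_ , (_ , i , i∈t , _) , _) , t⊆x , t⊆a) =
    i , x∈p∩q⁺ (t⊆x i∈t , t⊆a i∈t)

  ⁅⁆-isAtom : ∀ {i} → P ⁅ i ⁆ → IsAtom P ⁅ i ⁆
  ⁅⁆-isAtom {i} P⁅i⁆ = P⁅i⁆ , (⊥⊆ , i , x∈⁅x⁆ i , ∉⊥) , no-proper-nonempty-subset
    where
    no-proper-nonempty-subset : ∀ y → P y → _ → ¬ (y ⊂ ⁅ i ⁆)
    no-proper-nonempty-subset y _ (_ , j , j∈y , _) (y⊆⁅i⁆ , k , k∈⁅i⁆ , k∉y)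
      with x∈⁅y⁆⇒x≡y i (y⊆⁅i⁆ j∈y) | x∈⁅y⁆⇒x≡y i k∈⁅i⁆
    ... | refl | refl = k∉y j∈y

  Nonempty∩⇒sharesAtom : (∀ i → P ⁅ i ⁆) → ∀ {x a} → Nonempty (x ∩ a) → SharesAtom P x a
  Nonempty∩⇒sharesAtom singletons {x} {a} (i , i∈x∩a) =
    ⁅ i ⁆ , ⁅⁆-isAtom (singletons i) , ⁅i⁆⊆ i∈x , ⁅i⁆⊆ i∈a
    where
    i∈x = proj₁ (x∈p∩q⁻ x a i∈x∩a)
    i∈a = proj₂ (x∈p∩q⁻ x a i∈x∩a)
    ⁅i⁆⊆ : ∀ {y} → i ∈ y → ⁅ i ⁆ ⊆ y
    ⁅i⁆⊆ i∈y j∈⁅i⁆ with x∈⁅y⁆⇒x≡y i j∈⁅i⁆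
    ... | refl = i∈y

  transversal⇔ : (∀ i → P ⁅ i ⁆) → ∀ {A U} →
                 Transversal P A U ⇔ (P U × ¬ (∃ λ a → A a × a ⊆ ∁ U))
  transversal⇔ singletons = mk⇔
    (λ (PU , shares) → PU , λ (a , Aa , a⊆∁U) →
      to Nonempty∩⇔¬⊆∁ (sharesAtom⇒Nonempty∩ (shares a Aa)) a⊆∁U)
    (λ (PU , ∄a) → PU , λ a Aa →
      Nonempty∩⇒sharesAtom singletons (from Nonempty∩⇔¬⊆∁ λ a⊆∁U → ∄a (a , Aa , a⊆∁U)))

  transversal? : (∀ i → P ⁅ i ⁆) → Decidable P → ∀ {A} → Decidable A →
                 Decidable (Transversal P A)
  transversal? singletons P? A? U = map (⇔-sym (transversal⇔ singletons))
    (P? U ×-dec ¬? (anySubset? (λ a → A? a ×-dec (a ⊆? ∁ U))))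

  transversal-upClosed : ∀ {A} → UpClosedIn P (Transversal P A)
  transversal-upClosed (_ , shares) x⊆U PU = PU , λ a Aa →
    let (t , t-atom , t⊆x , t⊆a) = shares a Aa in t , t-atom , ⊆-trans t⊆x x⊆U , t⊆a

lemma2p5 : (n : ℕ) (P : Family n) → Admissible P → Decidable P →
           (A B : Family n) → Decidable A → Decidable B →
           IsAntichain P A → IsAntichain P B →
           ((∀ x → B x ⇔ Blocker P A x) ⇔
            (∀ U → P U → ((¬ (∃ λ a → A a × a ⊆ ∁ U)) ⇔ (∃ λ b → B b × b ⊆ U))))
lemma2p5 _ P adm P? A B A? _ _ antichain-B =
  ⇔-trans blocker⇔↑
    (mk⇔ (λ h U PU → ⇔-trans (⇔-sym (transversal⇔∄⊆∁ PU)) (h U PU))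
         (λ h U PU → ⇔-trans (transversal⇔∄⊆∁ PU) (h U PU)))
  where
  singletons = Admissible.has-singletons adm

  blocker⇔↑ : (∀ x → B x ⇔ Blocker P A x) ⇔
              (∀ U → P U → Transversal P A U ⇔ (↑ B) U)
  blocker⇔↑ = minimal⇔↑ (transversal? singletons P? A?) (λ _ → proj₁)
                transversal-upClosed antichain-B

  transversal⇔∄⊆∁ : ∀ {U} → P U → Transversal P A U ⇔ (¬ (∃ λ a → A a × a ⊆ ∁ U))
  transversal⇔∄⊆∁ PU = mk⇔ (λ T → proj₂ (to (transversal⇔ singletons) T))
                          (λ ∄a → from (transversal⇔ singletons) (PU , ∄a))
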